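{- The plactic monoid $\mathsf{plac}_3$ satisfies the identity $u_2(xy,yx) = v_2(xy,yx)$.
   Context: $\mathsf{plac}_3$ is the quotient of the free monoid on $\{1<2<3\}$ by the plactic (Knuth) congruence generated by $zxy = xzy$ for letters $x \le y < z$ and $yxz = yzx$ for letters $x < y \le z$. Words in variables $p,q$: $u_1(p,q) = pqppq$, $v_1(p,q) = pqqpq$, $u_2(p,q) = u_1(u_1(p,q), v_1(p,q))$, $v_2(p,q) = v_1(u_1(p,q), v_1(p,q))$; $u_2(xy,yx)$, $v_2(xy,yx)$ are the words in $x,y$ obtained by substituting $p = xy$, $q = yx$. A monoid satisfies an identity if the equality holds under every substitution of the variables by elements of the monoid. -}

module Defs where

open import Data.Fin using (Fin; _≤_; _<_)
open import Data.List using (List; []; _∷_; _++_)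

-- Letters of the alphabet {1 < 2 < 3}, represented as Fin 3 (0 < 1 < 2)
-- with the usual order.
Letter : Set
Letter = Fin 3

Word : Set
Word = List Letter

data Knuth : Word → Word → Set where
  knuth₁ : ∀ {x y z} → x ≤ y → y < z →
           Knuth (z ∷ x ∷ y ∷ []) (x ∷ z ∷ y ∷ [])
  knuth₂ : ∀ {x y z} → x < y → y ≤ z →
           Knuth (y ∷ x ∷ z ∷ []) (y ∷ z ∷ x ∷ [])

infix 4 _≈ₚ_
data _≈ₚ_ : Word → Word → Set where
  ≈-refl  : ∀ {w} → w ≈ₚ w
  ≈-sym   : ∀ {w w′} → w ≈ₚ w′ → w′ ≈ₚ w
  ≈-trans : ∀ {w w′ w″} → w ≈ₚ w′ → w′ ≈ₚ w″ → w ≈ₚ w″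
  ≈-knuth : ∀ u v {w w′} → Knuth w w′ → (u ++ w ++ v) ≈ₚ (u ++ w′ ++ v)

u₁ : Word → Word → Word
u₁ p q = p ++ q ++ p ++ p ++ q

v₁ : Word → Word → Word
v₁ p q = p ++ q ++ q ++ p ++ q

u₂ : Word → Word → Word
u₂ p q = u₁ (u₁ p q) (v₁ p q)

v₂ : Word → Word → Word
v₂ p q = v₁ (u₁ p q) (v₁ p q)

module Submission where

-- Two max-plus representations ρ L₁ and ρ L₃ of words by 3 × 3 upper triangular tropical
-- matrices respect the Knuth relations, and together they separate plactic classes: by
-- Schensted insertion every word is plactic to the reading word of a semistandard tableau,
-- and on reading words the diagonal, a₁₂ and a₁₃ of the first image and a₁₃ of the second
-- are Greene's invariants, which determine the tableau. So it suffices to prove the identity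
-- for tropical matrices. An entry of a max-plus product is a maximum over paths. If p and q
-- have the same diagonal, then in (pq) m (pq), m ∈ {p, q}, the paths leaving the diagonal
-- inside the middle factor are dominated by paths leaving it inside an outer factor, because
-- 2α + 2β ≤ max (4β, 3α + β) and 2α + 2β ≤ max (α + 3β, 4α). Hence u₁ = (pq) p (pq) and
-- v₁ = (pq) q (pq) agree everywhere except possibly at the corner (1,3), and the same
-- argument at the corner gives u₁ (u₁, v₁) = v₁ (u₁, v₁). The images of xy and yx have the
-- same diagonal since the diagonal is additive.

open import Defs
open import Data.Fin using (zero; suc)
import Data.Fin as Fin
import Data.Fin.Properties as Fin
open import Data.List using ([]; _∷_; _++_; replicate; foldl)
open import Data.List.Properties using (++-assoc; ++-identityʳ)
open import Data.Nat using (ℕ; zero; suc; _+_; _≤_; z≤n; s≤s) renaming (_⊔_ to infixl 5 _∨_)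
open import Data.Nat.Properties
open import Data.Nat.Tactic.RingSolver using (solve)
open import Data.Product using (_×_; _,_; proj₁; proj₂)
open import Data.Sum using (_⊎_; inj₁; inj₂)
open import Function using (_∘_)
open import Relation.Binary.PropositionalEquality
open import Relation.Nullary.Decidable using (Dec; True; toWitness; map′; _→-dec_; _×-dec_)
import Algebra.Solver.CommutativeMonoid as CommutativeMonoidSolver

-- Max-plus arithmetic

m≤n≤o⇒m∨n∨o≡o : ∀ {a b c} → a ≤ b → b ≤ c → a ∨ b ∨ c ≡ c
m≤n≤o⇒m∨n∨o≡o {c = c} a≤b b≤c = trans (cong (_∨ c) (m≤n⇒m⊔n≡n a≤b)) (m≤n⇒m⊔n≡n b≤c)

m≤n⇒m∨n∨o≡n∨o : ∀ {a b c} → a ≤ b → a ∨ b ∨ c ≡ b ∨ c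
m≤n⇒m∨n∨o≡n∨o {c = c} a≤b = cong (_∨ c) (m≤n⇒m⊔n≡n a≤b)

m+n∨n≡m+n : ∀ m n → m + n ∨ n ≡ m + n
m+n∨n≡m+n m n = m≥n⇒m⊔n≡m (m≤n+m n m)

+-distribʳ-∨-assoc : ∀ a b c d e → (a + b ∨ c + d) + e ≡ a + (b + e) ∨ c + (d + e)
+-distribʳ-∨-assoc a b c d e =
  trans (+-distribʳ-⊔ e (a + b) (c + d)) (cong₂ _∨_ (+-assoc a b e) (+-assoc c d e))

drop-dominated : ∀ a k t d → k + t ≤ a ∨ k + d → a ∨ k + (t ∨ d) ≡ a ∨ k + d
drop-dominated a k t d h = ≤-antisym
  (⊔-lub (m≤m⊔n a (k + d))
         (≤-trans (≤-reflexive (+-distribˡ-⊔ k t d)) (⊔-lub h (m≤n⊔m a (k + d)))))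
  (⊔-monoʳ-≤ a (+-monoʳ-≤ k (m≤n⊔m t d)))

middle-dominated : ∀ α β s x → s + β ≤ x ⊎ α + s ≤ x →
                   (α + α) + (s + (β + β)) ≤ x + (β + (β + β)) ∨ (α + α) + (α + x)
middle-dominated α β s x h with ≤-total α β | h
... | inj₁ α≤β | inj₁ s+β≤x = ≤-trans (begin
  (α + α) + (s + (β + β)) ≤⟨ +-monoˡ-≤ _ (+-mono-≤ α≤β α≤β) ⟩
  (β + β) + (s + (β + β)) ≡⟨ solve (β ∷ s ∷ []) ⟩
  (s + β) + (β + (β + β)) ≤⟨ +-monoˡ-≤ _ s+β≤x ⟩
  x + (β + (β + β))       ∎) (m≤m⊔n _ _)
  where open ≤-Reasoning
... | inj₁ α≤β | inj₂ α+s≤x = ≤-trans (begin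
  (α + α) + (s + (β + β)) ≡⟨ solve (α ∷ β ∷ s ∷ []) ⟩
  (α + s) + (α + (β + β)) ≤⟨ +-mono-≤ α+s≤x (+-monoˡ-≤ _ α≤β) ⟩
  x + (β + (β + β))       ∎) (m≤m⊔n _ _)
  where open ≤-Reasoning
... | inj₂ β≤α | inj₁ s+β≤x = ≤-trans (begin
  (α + α) + (s + (β + β)) ≤⟨ +-monoʳ-≤ (α + α) (+-monoʳ-≤ s (+-monoˡ-≤ β β≤α)) ⟩
  (α + α) + (s + (α + β)) ≡⟨ cong ((α + α) +_) (solve (α ∷ β ∷ s ∷ [])) ⟩
  (α + α) + (α + (s + β)) ≤⟨ +-monoʳ-≤ (α + α) (+-monoʳ-≤ α s+β≤x) ⟩
  (α + α) + (α + x)       ∎) (m≤n⊔m _ _)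
  where open ≤-Reasoning
... | inj₂ β≤α | inj₂ α+s≤x = ≤-trans (begin
  (α + α) + (s + (β + β)) ≤⟨ +-monoʳ-≤ (α + α) (+-monoʳ-≤ s (+-mono-≤ β≤α β≤α)) ⟩
  (α + α) + (s + (α + α)) ≡⟨ cong ((α + α) +_) (solve (α ∷ s ∷ [])) ⟩
  (α + α) + (α + (α + s)) ≤⟨ +-monoʳ-≤ (α + α) (+-monoʳ-≤ α α+s≤x) ⟩
  (α + α) + (α + x)       ∎) (m≤n⊔m _ _)
  where open ≤-Reasoning

-- Upper triangular max-plus matrices

record UT₂ : Set where
  constructor mk₂
  field d₁ d₂ a₁₂ : ℕ

infixl 7 _·₂_
_·₂_ : UT₂ → UT₂ → UT₂
x ·₂ y = mk₂ (d₁ x + d₁ y) (d₂ x + d₂ y) (a₁₂ x + d₂ y ∨ d₁ x + a₁₂ y)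
  where open UT₂

UT₂-≡ : ∀ {x y} → UT₂.d₁ x ≡ UT₂.d₁ y → UT₂.d₂ x ≡ UT₂.d₂ y → UT₂.a₁₂ x ≡ UT₂.a₁₂ y → x ≡ y
UT₂-≡ refl refl refl = refl

·₂-assoc : ∀ x y z → (x ·₂ y) ·₂ z ≡ x ·₂ (y ·₂ z)
·₂-assoc (mk₂ x₁ x₂ x₁₂) (mk₂ y₁ y₂ y₁₂) (mk₂ z₁ z₂ z₁₂) =
  UT₂-≡ (+-assoc x₁ y₁ z₁) (+-assoc x₂ y₂ z₂) (begin
    (x₁₂ + y₂ ∨ x₁ + y₁₂) + z₂ ∨ (x₁ + y₁) + z₁₂
      ≡⟨ cong₂ _∨_ (+-distribʳ-∨-assoc x₁₂ y₂ x₁ y₁₂ z₂) (+-assoc x₁ y₁ z₁₂) ⟩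
    x₁₂ + (y₂ + z₂) ∨ x₁ + (y₁₂ + z₂) ∨ x₁ + (y₁ + z₁₂)
      ≡⟨ ⊔-assoc (x₁₂ + (y₂ + z₂)) _ _ ⟩
    x₁₂ + (y₂ + z₂) ∨ (x₁ + (y₁₂ + z₂) ∨ x₁ + (y₁ + z₁₂))
      ≡⟨ cong (x₁₂ + (y₂ + z₂) ∨_) (+-distribˡ-⊔ x₁ _ _) ⟨
    x₁₂ + (y₂ + z₂) ∨ x₁ + (y₁₂ + z₂ ∨ y₁ + z₁₂) ∎)
  where open ≡-Reasoning

record UT : Set where
  constructor mk
  field d₁ d₂ d₃ a₁₂ a₁₃ a₂₃ : ℕ
open UT

infixl 7 _·_
_·_ : UT → UT → UT
x · y = mk (d₁ x + d₁ y) (d₂ x + d₂ y) (d₃ x + d₃ y)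
           (a₁₂ x + d₂ y ∨ d₁ x + a₁₂ y)
           (a₁₃ x + d₃ y ∨ a₁₂ x + a₂₃ y ∨ d₁ x + a₁₃ y)
           (a₂₃ x + d₃ y ∨ d₂ x + a₂₃ y)

upper lower : UT → UT₂
upper x = mk₂ (d₁ x) (d₂ x) (a₁₂ x)
lower x = mk₂ (d₂ x) (d₃ x) (a₂₃ x)

diag : UT → ℕ × ℕ × ℕ
diag x = d₁ x , d₂ x , d₃ x

UT-≡ : ∀ {x y} → d₁ x ≡ d₁ y → d₂ x ≡ d₂ y → d₃ x ≡ d₃ y →
       a₁₂ x ≡ a₁₂ y → a₁₃ x ≡ a₁₃ y → a₂₃ x ≡ a₂₃ y → x ≡ y
UT-≡ refl refl refl refl refl refl = refl

_≟ᵤ_ : (x y : UT) → Dec (x ≡ y)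
x ≟ᵤ y = map′ (λ (e₁ , e₂ , e₃ , e₁₂ , e₁₃ , e₂₃) → UT-≡ e₁ e₂ e₃ e₁₂ e₁₃ e₂₃)
              (λ { refl → refl , refl , refl , refl , refl , refl })
              (d₁ x ≟ d₁ y ×-dec d₂ x ≟ d₂ y ×-dec d₃ x ≟ d₃ y ×-dec
               a₁₂ x ≟ a₁₂ y ×-dec a₁₃ x ≟ a₁₃ y ×-dec a₂₃ x ≟ a₂₃ y)

·-assoc : ∀ x y z → (x · y) · z ≡ x · (y · z)
·-assoc x y z = UT-≡ (+-assoc (d₁ x) _ _) (+-assoc (d₂ x) _ _) (+-assoc (d₃ x) _ _)
  (cong UT₂.a₁₂ (·₂-assoc (upper x) (upper y) (upper z)))
  (a₁₃-assoc (d₁ x) (a₁₂ x) (a₁₃ x) (d₁ y) (d₂ y) (d₃ y) (a₁₂ y) (a₁₃ y) (a₂₃ y) (d₃ z) (a₁₃ z) (a₂₃ z))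
  (cong UT₂.a₁₂ (·₂-assoc (lower x) (lower y) (lower z)))
  where
  open ≡-Reasoning
  open CommutativeMonoidSolver ⊔-0-commutativeMonoid using (_⊕_; _⊜_) renaming (solve to ∨-solve)
  -- both sides are the maximum over the six paths from 1 to 3 through the three factors
  a₁₃-assoc : ∀ x₁ x₁₂ x₁₃ y₁ y₂ y₃ y₁₂ y₁₃ y₂₃ z₃ z₁₃ z₂₃ →
    (x₁₃ + y₃ ∨ x₁₂ + y₂₃ ∨ x₁ + y₁₃) + z₃ ∨ (x₁₂ + y₂ ∨ x₁ + y₁₂) + z₂₃ ∨ (x₁ + y₁) + z₁₃ ≡
    x₁₃ + (y₃ + z₃) ∨ x₁₂ + (y₂₃ + z₃ ∨ y₂ + z₂₃) ∨ x₁ + (y₁₃ + z₃ ∨ y₁₂ + z₂₃ ∨ y₁ + z₁₃)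
  a₁₃-assoc x₁ x₁₂ x₁₃ y₁ y₂ y₃ y₁₂ y₁₃ y₂₃ z₃ z₁₃ z₂₃ = begin
    (x₁₃ + y₃ ∨ x₁₂ + y₂₃ ∨ x₁ + y₁₃) + z₃ ∨ (x₁₂ + y₂ ∨ x₁ + y₁₂) + z₂₃ ∨ (x₁ + y₁) + z₁₃
      ≡⟨ cong₂ _∨_ (cong₂ _∨_
           (trans (+-distribʳ-⊔ z₃ (x₁₃ + y₃ ∨ x₁₂ + y₂₃) (x₁ + y₁₃))
                  (cong₂ _∨_ (+-distribʳ-∨-assoc x₁₃ y₃ x₁₂ y₂₃ z₃) (+-assoc x₁ y₁₃ z₃)))
           (+-distribʳ-∨-assoc x₁₂ y₂ x₁ y₁₂ z₂₃))
         (+-assoc x₁ y₁ z₁₃) ⟩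
    A ∨ B ∨ C ∨ (D ∨ E) ∨ F
      ≡⟨ ∨-solve 6 (λ A B C D E F → (((A ⊕ B) ⊕ C) ⊕ (D ⊕ E)) ⊕ F ⊜ (A ⊕ (B ⊕ D)) ⊕ ((C ⊕ E) ⊕ F))
                 refl A B C D E F ⟩
    A ∨ (B ∨ D) ∨ (C ∨ E ∨ F)
      ≡⟨ cong₂ _∨_ (cong (A ∨_) (+-distribˡ-⊔ x₁₂ _ _))
           (trans (+-distribˡ-⊔ x₁ _ _) (cong (_∨ F) (+-distribˡ-⊔ x₁ _ _))) ⟨
    x₁₃ + (y₃ + z₃) ∨ x₁₂ + (y₂₃ + z₃ ∨ y₂ + z₂₃) ∨ x₁ + (y₁₃ + z₃ ∨ y₁₂ + z₂₃ ∨ y₁ + z₁₃) ∎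
    where
    A = x₁₃ + (y₃ + z₃)
    B = x₁₂ + (y₂₃ + z₃)
    C = x₁ + (y₁₃ + z₃)
    D = x₁₂ + (y₂ + z₂₃)
    E = x₁ + (y₁₂ + z₂₃)
    F = x₁ + (y₁ + z₁₃)

diag-·-comm : ∀ x y → diag (x · y) ≡ diag (y · x)
diag-·-comm x y = cong₂ _,_ (+-comm (d₁ x) _) (cong₂ _,_ (+-comm (d₂ x) _) (+-comm (d₃ x) _))

sandwich₂ : UT₂ → UT₂ → UT₂
sandwich₂ w m = w ·₂ (m ·₂ w)

sandwich : UT → UT → UT
sandwich w m = w · (m · w)

sandwich₂-middle : ∀ α β s s′ → let p = mk₂ α β s; q = mk₂ α β s′ in
                   sandwich₂ (p ·₂ q) p ≡ sandwich₂ (p ·₂ q) q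
sandwich₂-middle α β s s′ =
  UT₂-≡ refl refl (trans (drop s (inj₁ (m≤m⊔n (s + β) (α + s′))))
                        (sym (drop s′ (inj₂ (m≤n⊔m (s + β) (α + s′))))))
  where
  c = s + β ∨ α + s′
  drop : ∀ t → t + β ≤ c ⊎ α + t ≤ c →
         c + (β + (β + β)) ∨ (α + α) + (t + (β + β) ∨ α + c) ≡ c + (β + (β + β)) ∨ (α + α) + (α + c)
  drop t h = drop-dominated (c + (β + (β + β))) (α + α) (t + (β + β)) (α + c) (middle-dominated α β t c h)

sandwich-middle-corner : ∀ α β γ x y s s′ → let p = mk α β γ x s y; q = mk α β γ x s′ y in
                         sandwich (p · q) p ≡ sandwich (p · q) q
sandwich-middle-corner α β γ x y s s′ =
  UT-≡ refl refl refl refl (trans (drop s (inj₁ (m≤n⇒m≤n⊔o (α + s′) (m≤m⊔n (s + γ) (x + y)))))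
                                  (sym (drop s′ (inj₂ (m≤n⊔m (s + γ ∨ x + y) (α + s′)))))) refl
  where
  c = s + γ ∨ x + y ∨ α + s′
  a₂₃w = y + γ ∨ β + y
  a = c + (γ + (γ + γ)) ∨ (x + β ∨ α + x) + (y + (γ + γ) ∨ β + a₂₃w)
  d = x + a₂₃w ∨ α + c
  drop : ∀ t → t + γ ≤ c ⊎ α + t ≤ c →
         a ∨ (α + α) + (t + (γ + γ) ∨ x + a₂₃w ∨ α + c) ≡ a ∨ (α + α) + d
  drop t h = trans (cong (λ e → a ∨ (α + α) + e) (⊔-assoc (t + (γ + γ)) _ _))
                   (drop-dominated a (α + α) (t + (γ + γ)) d
                     (≤-trans (middle-dominated α γ t c h)
                              (⊔-mono-≤ (m≤m⊔n _ _) (+-monoʳ-≤ (α + α) (m≤n⊔m _ _)))))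

sandwich²-middle : ∀ p q → diag p ≡ diag q →
                   let P = sandwich (p · q) p; Q = sandwich (p · q) q in
                   sandwich (P · Q) P ≡ sandwich (P · Q) Q
sandwich²-middle (mk α β γ x s y) (mk .α .β .γ x′ s′ y′) refl = begin
  sandwich (P · Q) P   ≡⟨ cong (λ Q → sandwich (P · Q) P) Q≡Q′ ⟩
  sandwich (P · Q′) P  ≡⟨ sandwich-middle-corner (d₁ P) (d₂ P) (d₃ P) (a₁₂ P) (a₂₃ P) (a₁₃ P) (a₁₃ Q) ⟩
  sandwich (P · Q′) Q′ ≡⟨ cong (λ Q → sandwich (P · Q) Q) Q≡Q′ ⟨
  sandwich (P · Q) Q   ∎
  where
  open ≡-Reasoning
  p = mk α β γ x s y
  q = mk α β γ x′ s′ y′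
  P = sandwich (p · q) p
  Q = sandwich (p · q) q
  Q′ = mk (d₁ P) (d₂ P) (d₃ P) (a₁₂ P) (a₁₃ Q) (a₂₃ P)
  Q≡Q′ : Q ≡ Q′
  Q≡Q′ = UT-≡ refl refl refl (sym (cong UT₂.a₁₂ (sandwich₂-middle α β x x′)))
              refl (sym (cong UT₂.a₁₂ (sandwich₂-middle β γ y y′)))

-- Representations of words

O : UT
O = mk 0 0 0 0 0 0

-- O is not a two-sided identity of the max-plus semigroup (that would need −∞ entries),
-- but it is a left identity on the admissible matrices, which form a right ideal.
record Admissible (x : UT) : Set where
  constructor admissible
  field d₂≤a₁₂ : d₂ x ≤ a₁₂ x
        d₃≤a₂₃ : d₃ x ≤ a₂₃ x
        a₂₃≤a₁₃ : a₂₃ x ≤ a₁₃ x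

O·-identity : ∀ {x} → Admissible x → O · x ≡ x
O·-identity (admissible d₂≤a₁₂ d₃≤a₂₃ a₂₃≤a₁₃) =
  UT-≡ refl refl refl (m≤n⇒m⊔n≡n d₂≤a₁₂) (m≤n≤o⇒m∨n∨o≡o d₃≤a₂₃ a₂₃≤a₁₃) (m≤n⇒m⊔n≡n d₃≤a₂₃)

admissible-· : ∀ {x} y → Admissible x → Admissible (x · y)
admissible-· {x} y (admissible p q r) = admissible
  (m≤n⇒m≤n⊔o _ (+-monoˡ-≤ (d₂ y) p))
  (m≤n⇒m≤n⊔o _ (+-monoˡ-≤ (d₃ y) q))
  (⊔-lub (m≤n⇒m≤n⊔o _ (m≤n⇒m≤n⊔o _ (+-monoˡ-≤ (d₃ y) r)))
         (m≤n⇒m≤n⊔o _ (m≤n⇒m≤o⊔n (a₁₃ x + d₃ y) (+-monoˡ-≤ (a₂₃ y) p))))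

ρ : (Letter → UT) → Word → UT
ρ L []      = O
ρ L (l ∷ w) = L l · ρ L w

module _ {L : Letter → UT} (L-admissible : ∀ l → Admissible (L l)) where

  ρ-admissible : ∀ w → Admissible (ρ L w)
  ρ-admissible []      = admissible z≤n z≤n z≤n
  ρ-admissible (l ∷ w) = admissible-· (ρ L w) (L-admissible l)

  ρ-++ : ∀ u w → ρ L (u ++ w) ≡ ρ L u · ρ L w
  ρ-++ []      w = sym (O·-identity (ρ-admissible w))
  ρ-++ (l ∷ u) w = trans (cong (L l ·_) (ρ-++ u w)) (sym (·-assoc (L l) (ρ L u) (ρ L w)))

  ρ-resp-≈ₚ : (∀ {w w′} → Knuth w w′ → ρ L w ≡ ρ L w′) → ∀ {w w′} → w ≈ₚ w′ → ρ L w ≡ ρ L w′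
  ρ-resp-≈ₚ knuth ≈-refl        = refl
  ρ-resp-≈ₚ knuth (≈-sym p)     = sym (ρ-resp-≈ₚ knuth p)
  ρ-resp-≈ₚ knuth (≈-trans p q) = trans (ρ-resp-≈ₚ knuth p) (ρ-resp-≈ₚ knuth q)
  ρ-resp-≈ₚ knuth (≈-knuth u v {w} {w′} k) = begin
    ρ L (u ++ w ++ v)        ≡⟨ ρ-++ u (w ++ v) ⟩
    ρ L u · ρ L (w ++ v)     ≡⟨ cong (ρ L u ·_) (ρ-++ w v) ⟩
    ρ L u · (ρ L w · ρ L v)  ≡⟨ cong (λ m → ρ L u · (m · ρ L v)) (knuth k) ⟩
    ρ L u · (ρ L w′ · ρ L v) ≡⟨ cong (ρ L u ·_) (ρ-++ w′ v) ⟨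
    ρ L u · ρ L (w′ ++ v)    ≡⟨ ρ-++ u (w′ ++ v) ⟨
    ρ L (u ++ w′ ++ v)       ∎
    where open ≡-Reasoning

  private
    ⟦_⟧ : Word → UT
    ⟦_⟧ = ρ L

  ρ-sandwich : ∀ a b c d e → ⟦ a ++ b ++ c ++ d ++ e ⟧ ≡ (⟦ a ⟧ · ⟦ b ⟧) · (⟦ c ⟧ · (⟦ d ⟧ · ⟦ e ⟧))
  ρ-sandwich a b c d e = begin
    ⟦ a ++ b ++ c ++ d ++ e ⟧                  ≡⟨ ρ-++ a (b ++ c ++ d ++ e) ⟩
    ⟦ a ⟧ · ⟦ b ++ c ++ d ++ e ⟧                ≡⟨ cong (⟦ a ⟧ ·_) (ρ-++ b (c ++ d ++ e)) ⟩
    ⟦ a ⟧ · (⟦ b ⟧ · ⟦ c ++ d ++ e ⟧)           ≡⟨ ·-assoc ⟦ a ⟧ ⟦ b ⟧ _ ⟨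
    (⟦ a ⟧ · ⟦ b ⟧) · ⟦ c ++ d ++ e ⟧           ≡⟨ cong ((⟦ a ⟧ · ⟦ b ⟧) ·_) (ρ-++ c (d ++ e)) ⟩
    (⟦ a ⟧ · ⟦ b ⟧) · (⟦ c ⟧ · ⟦ d ++ e ⟧)      ≡⟨ cong (λ m → (⟦ a ⟧ · ⟦ b ⟧) · (⟦ c ⟧ · m)) (ρ-++ d e) ⟩
    (⟦ a ⟧ · ⟦ b ⟧) · (⟦ c ⟧ · (⟦ d ⟧ · ⟦ e ⟧)) ∎
    where open ≡-Reasoning

  ρ-u₂≡v₂ : ∀ x y → ⟦ u₂ (x ++ y) (y ++ x) ⟧ ≡ ⟦ v₂ (x ++ y) (y ++ x) ⟧
  ρ-u₂≡v₂ x y = begin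
    ⟦ u₁ (u₁ p q) (v₁ p q) ⟧                      ≡⟨ ρ-u₁ (u₁ p q) (v₁ p q) ⟩
    sandwich (⟦ u₁ p q ⟧ · ⟦ v₁ p q ⟧) ⟦ u₁ p q ⟧ ≡⟨ cong₂ (λ U V → sandwich (U · V) U) (ρ-u₁ p q) (ρ-v₁ p q) ⟩
    sandwich (P · Q) P                            ≡⟨ sandwich²-middle ⟦ p ⟧ ⟦ q ⟧ diag-p≡diag-q ⟩
    sandwich (P · Q) Q                            ≡⟨ cong₂ (λ U V → sandwich (U · V) V) (ρ-u₁ p q) (ρ-v₁ p q) ⟨
    sandwich (⟦ u₁ p q ⟧ · ⟦ v₁ p q ⟧) ⟦ v₁ p q ⟧ ≡⟨ ρ-v₁ (u₁ p q) (v₁ p q) ⟨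
    ⟦ v₁ (u₁ p q) (v₁ p q) ⟧                      ∎
    where
    open ≡-Reasoning
    p = x ++ y
    q = y ++ x
    P = sandwich (⟦ p ⟧ · ⟦ q ⟧) ⟦ p ⟧
    Q = sandwich (⟦ p ⟧ · ⟦ q ⟧) ⟦ q ⟧
    ρ-u₁ : ∀ a b → ⟦ u₁ a b ⟧ ≡ sandwich (⟦ a ⟧ · ⟦ b ⟧) ⟦ a ⟧
    ρ-u₁ a b = ρ-sandwich a b a a b
    ρ-v₁ : ∀ a b → ⟦ v₁ a b ⟧ ≡ sandwich (⟦ a ⟧ · ⟦ b ⟧) ⟦ b ⟧
    ρ-v₁ a b = ρ-sandwich a b b a b
    diag-p≡diag-q : diag ⟦ p ⟧ ≡ diag ⟦ q ⟧
    diag-p≡diag-q = begin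
      diag ⟦ x ++ y ⟧      ≡⟨ cong diag (ρ-++ x y) ⟩
      diag (⟦ x ⟧ · ⟦ y ⟧) ≡⟨ diag-·-comm ⟦ x ⟧ ⟦ y ⟧ ⟩
      diag (⟦ y ⟧ · ⟦ x ⟧) ≡⟨ cong diag (ρ-++ y x) ⟨
      diag ⟦ y ++ x ⟧      ∎

module _ (L : Letter → UT) where

  knuth₁? : Dec (∀ x y z → x Fin.≤ y → y Fin.< z → ρ L (z ∷ x ∷ y ∷ []) ≡ ρ L (x ∷ z ∷ y ∷ []))
  knuth₁? = Fin.all? λ x → Fin.all? λ y → Fin.all? λ z →
            x Fin.≤? y →-dec y Fin.<? z →-dec ρ L (z ∷ x ∷ y ∷ []) ≟ᵤ ρ L (x ∷ z ∷ y ∷ [])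

  knuth₂? : Dec (∀ x y z → x Fin.< y → y Fin.≤ z → ρ L (y ∷ x ∷ z ∷ []) ≡ ρ L (y ∷ z ∷ x ∷ []))
  knuth₂? = Fin.all? λ x → Fin.all? λ y → Fin.all? λ z →
            x Fin.<? y →-dec y Fin.≤? z →-dec ρ L (y ∷ x ∷ z ∷ []) ≟ᵤ ρ L (y ∷ z ∷ x ∷ [])

  ρ-knuth : True knuth₁? → True knuth₂? → ∀ {w w′} → Knuth w w′ → ρ L w ≡ ρ L w′
  ρ-knuth k₁ _ (knuth₁ x≤y y<z) = toWitness k₁ _ _ _ x≤y y<z
  ρ-knuth _ k₂ (knuth₂ x<y y≤z) = toWitness k₂ _ _ _ x<y y≤z

pattern one   = zero
pattern two   = suc zero
pattern three = suc (suc zero)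

-- On reading words of semistandard tableaux, a₁₃ ∘ ρ L₁ is the length of the first row and
-- a₁₃ ∘ ρ L₃ the total length of the first two rows (see wordInvariants-reading).
L₁ L₃ : Letter → UT
L₁ one   = mk 1 0 0 1 1 0
L₁ two   = mk 0 1 0 1 1 1
L₁ three = mk 0 0 1 0 1 1
L₃ one   = mk 1 1 0 1 1 1
L₃ two   = mk 1 0 1 1 1 1
L₃ three = mk 0 1 1 1 1 1

L₁-admissible : ∀ l → Admissible (L₁ l)
L₁-admissible one   = admissible z≤n z≤n z≤n
L₁-admissible two   = admissible (s≤s z≤n) z≤n (s≤s z≤n)
L₁-admissible three = admissible z≤n (s≤s z≤n) (s≤s z≤n)

L₃-admissible : ∀ l → Admissible (L₃ l)
L₃-admissible one   = admissible (s≤s z≤n) z≤n (s≤s z≤n)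
L₃-admissible two   = admissible z≤n (s≤s z≤n) (s≤s z≤n)
L₃-admissible three = admissible (s≤s z≤n) (s≤s z≤n) (s≤s z≤n)

ρ₁-knuth : ∀ {w w′} → Knuth w w′ → ρ L₁ w ≡ ρ L₁ w′
ρ₁-knuth = ρ-knuth L₁ _ _

ρ₃-knuth : ∀ {w w′} → Knuth w w′ → ρ L₃ w ≡ ρ L₃ w′
ρ₃-knuth = ρ-knuth L₃ _ _

-- Plactic rewriting and Schensted insertion

infixr 8 _^_
_^_ : Letter → ℕ → Word
l ^ n = replicate n l

^-snoc : ∀ l n s → l ^ n ++ l ∷ s ≡ l ∷ l ^ n ++ s
^-snoc l zero    s = refl
^-snoc l (suc n) s = cong (l ∷_) (^-snoc l n s)

≡⇒≈ₚ : ∀ {w w′} → w ≡ w′ → w ≈ₚ w′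
≡⇒≈ₚ refl = ≈-refl

infixr 4 _⟫_
_⟫_ : ∀ {w w′ w″} → w ≈ₚ w′ → w′ ≈ₚ w″ → w ≈ₚ w″
_⟫_ = ≈-trans

≈ₚ-++ˡ : ∀ u {w w′} → w ≈ₚ w′ → u ++ w ≈ₚ u ++ w′
≈ₚ-++ˡ u ≈-refl        = ≈-refl
≈ₚ-++ˡ u (≈-sym p)     = ≈-sym (≈ₚ-++ˡ u p)
≈ₚ-++ˡ u (≈-trans p q) = ≈ₚ-++ˡ u p ⟫ ≈ₚ-++ˡ u q
≈ₚ-++ˡ u (≈-knuth u′ v {w} {w′} k) =
  subst₂ _≈ₚ_ (++-assoc u u′ (w ++ v)) (++-assoc u u′ (w′ ++ v)) (≈-knuth (u ++ u′) v k)

xzy≈zxy : ∀ {x y z} → x Fin.≤ y → y Fin.< z → ∀ s → x ∷ z ∷ y ∷ s ≈ₚ z ∷ x ∷ y ∷ s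
xzy≈zxy x≤y y<z s = ≈-sym (≈-knuth [] s (knuth₁ x≤y y<z))

yzx≈yxz : ∀ {x y z} → x Fin.< y → y Fin.≤ z → ∀ s → y ∷ z ∷ x ∷ s ≈ₚ y ∷ x ∷ z ∷ s
yzx≈yxz x<y y≤z s = ≈-sym (≈-knuth [] s (knuth₂ x<y y≤z))

yⁿ⁺¹x≈yxyⁿ : ∀ {x y} → x Fin.< y → ∀ n s → y ^ suc n ++ x ∷ s ≈ₚ y ∷ x ∷ y ^ n ++ s
yⁿ⁺¹x≈yxyⁿ x<y zero    s = ≈-refl
yⁿ⁺¹x≈yxyⁿ {y = y} x<y (suc n) s =
  ≈ₚ-++ˡ (y ∷ []) (yⁿ⁺¹x≈yxyⁿ x<y n s) ⟫ yzx≈yxz x<y Fin.≤-refl (y ^ n ++ s)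

xⁿyx≈yxⁿ⁺¹ : ∀ {x y} → x Fin.< y → ∀ n s → x ^ n ++ y ∷ x ∷ s ≈ₚ y ∷ x ^ suc n ++ s
xⁿyx≈yxⁿ⁺¹ x<y zero    s = ≈-refl
xⁿyx≈yxⁿ⁺¹ {x} x<y (suc n) s =
  ≈ₚ-++ˡ (x ∷ []) (xⁿyx≈yxⁿ⁺¹ x<y n s) ⟫ xzy≈zxy Fin.≤-refl x<y (x ^ n ++ s)

wⁿzx≈zwⁿx : ∀ {w x z} → w Fin.≤ x → x Fin.< z → ∀ n s → w ^ n ++ z ∷ x ∷ s ≈ₚ z ∷ w ^ n ++ x ∷ s
wⁿzx≈zwⁿx w≤x x<z zero          s = ≈-refl
wⁿzx≈zwⁿx w≤x x<z (suc zero)    s = xzy≈zxy w≤x x<z s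
wⁿzx≈zwⁿx {w} {x} w≤x x<z (suc (suc n)) s =
  ≈ₚ-++ˡ (w ∷ []) (wⁿzx≈zwⁿx w≤x x<z (suc n) s)
  ⟫ xzy≈zxy Fin.≤-refl (≤-<-trans w≤x x<z) (w ^ n ++ x ∷ s)

xyⁿw≈xwyⁿ : ∀ {w x y} → w Fin.< x → x Fin.≤ y → ∀ n s → x ∷ y ^ n ++ w ∷ s ≈ₚ x ∷ w ∷ y ^ n ++ s
xyⁿw≈xwyⁿ w<x x≤y zero    s = ≈-refl
xyⁿw≈xwyⁿ {x = x} {y} w<x x≤y (suc n) s =
  ≈ₚ-++ˡ (x ∷ []) (yⁿ⁺¹x≈yxyⁿ (<-≤-trans w<x x≤y) n s) ⟫ yzx≈yxz w<x x≤y (y ^ n ++ s)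

1≤1 : Fin._≤_ {3} {3} one one
1≤1 = z≤n
1≤2 : Fin._≤_ {3} {3} one two
1≤2 = z≤n
2≤3 : Fin._≤_ {3} {3} two three
2≤3 = s≤s z≤n
1<2 : Fin._<_ {3} {3} one two
1<2 = s≤s z≤n
1<3 : Fin._<_ {3} {3} one three
1<3 = s≤s z≤n
2<3 : Fin._<_ {3} {3} two three
2<3 = s≤s (s≤s z≤n)

row : ℕ → ℕ → ℕ → Word → Word
row i j k s = one ^ i ++ two ^ j ++ three ^ k ++ s

row-cong : ∀ i j k {s s′} → s ≈ₚ s′ → row i j k s ≈ₚ row i j k s′
row-cong i j k s≈s′ = ≈ₚ-++ˡ (one ^ i) (≈ₚ-++ˡ (two ^ j) (≈ₚ-++ˡ (three ^ k) s≈s′))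

row-append-3 : ∀ i j k s → row i j k (three ∷ s) ≡ row i j (suc k) s
row-append-3 i j k s = cong (one ^ i ++_) (cong (two ^ j ++_) (^-snoc three k s))

row-append-2 : ∀ i j s → row i j 0 (two ∷ s) ≡ row i (suc j) 0 s
row-append-2 i j s = cong (one ^ i ++_) (^-snoc two j s)

row-append-1 : ∀ i s → row i 0 0 (one ∷ s) ≡ row (suc i) 0 0 s
row-append-1 i s = ^-snoc one i s

row-bump-3-by-2 : ∀ i j k s → row i j (suc k) (two ∷ s) ≈ₚ three ∷ row i (suc j) k s
row-bump-3-by-2 i j k s =
  ≈ₚ-++ˡ (one ^ i) (≈ₚ-++ˡ (two ^ j) (yⁿ⁺¹x≈yxyⁿ 2<3 k s) ⟫ xⁿyx≈yxⁿ⁺¹ 2<3 j (three ^ k ++ s))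
  ⟫ wⁿzx≈zwⁿx 1≤2 2<3 i (two ^ j ++ three ^ k ++ s)

row-bump-2-by-1 : ∀ i j k s → row i (suc j) k (one ∷ s) ≈ₚ two ∷ row (suc i) j k s
row-bump-2-by-1 i j k s =
  ≈ₚ-++ˡ (one ^ i) (move-1-past-3s ⟫ yⁿ⁺¹x≈yxyⁿ 1<2 j (three ^ k ++ s))
  ⟫ xⁿyx≈yxⁿ⁺¹ 1<2 i (two ^ j ++ three ^ k ++ s)
  where
  move-1-past-3s : two ^ suc j ++ three ^ k ++ one ∷ s ≈ₚ two ^ suc j ++ one ∷ three ^ k ++ s
  move-1-past-3s = ≡⇒≈ₚ (sym (^-snoc two j _))
                 ⟫ ≈ₚ-++ˡ (two ^ j) (xyⁿw≈xwyⁿ 1<2 2≤3 k s)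
                 ⟫ ≡⇒≈ₚ (^-snoc two j _)

row-bump-3-by-1 : ∀ i k s → row i 0 (suc k) (one ∷ s) ≈ₚ three ∷ row (suc i) 0 k s
row-bump-3-by-1 i k s =
  ≈ₚ-++ˡ (one ^ i) (yⁿ⁺¹x≈yxyⁿ 1<3 k s)
  ⟫ wⁿzx≈zwⁿx 1≤1 1<3 i (three ^ k ++ s)
  ⟫ ≈ₚ-++ˡ (three ∷ []) (≡⇒≈ₚ (^-snoc one i _))

-- tableau a b c d e f has rows 1ᵃ2ᵇ3ᶜ, 2ᵈ3ᵉ and 3ᶠ; read t s is its reading word followed by s.
record Tableau : Set where
  constructor tableau
  field a b c d e f : ℕ

read : Tableau → Word → Word
read (tableau a b c d e f) s = row 0 0 f (row 0 d e (row a b c s))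

insert : Tableau → Letter → Tableau
insert (tableau a b c       d e       f) three = tableau a b (suc c) d e f
insert (tableau a b zero    d e       f) two   = tableau a (suc b) zero d e f
insert (tableau a b (suc c) d e       f) two   = tableau a (suc b) c d (suc e) f
insert (tableau a (suc b) c d zero    f) one   = tableau (suc a) b c (suc d) zero f
insert (tableau a (suc b) c d (suc e) f) one   = tableau (suc a) b c (suc d) e (suc f)
insert (tableau a zero (suc c) d e    f) one   = tableau (suc a) zero c d (suc e) f
insert (tableau a zero zero    d e    f) one   = tableau (suc a) zero zero d e f

read-insert : ∀ t l s → read t (l ∷ s) ≈ₚ read (insert t l) s
read-insert (tableau a b c d e f) three s =
  row-cong 0 0 f (row-cong 0 d e (≡⇒≈ₚ (row-append-3 a b c s)))
read-insert (tableau a b zero d e f) two s =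
  row-cong 0 0 f (row-cong 0 d e (≡⇒≈ₚ (row-append-2 a b s)))
read-insert (tableau a b (suc c) d e f) two s =
  row-cong 0 0 f (row-cong 0 d e (row-bump-3-by-2 a b c s)
                  ⟫ ≡⇒≈ₚ (row-append-3 0 d e _))
read-insert (tableau a (suc b) c d zero f) one s =
  row-cong 0 0 f (row-cong 0 d 0 (row-bump-2-by-1 a b c s)
                  ⟫ ≡⇒≈ₚ (row-append-2 0 d _))
read-insert (tableau a (suc b) c d (suc e) f) one s =
  row-cong 0 0 f (row-cong 0 d (suc e) (row-bump-2-by-1 a b c s)
                  ⟫ row-bump-3-by-2 0 d e _)
  ⟫ ≡⇒≈ₚ (row-append-3 0 0 f _)
read-insert (tableau a zero (suc c) d e f) one s =
  row-cong 0 0 f (row-cong 0 d e (row-bump-3-by-1 a c s)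
                  ⟫ ≡⇒≈ₚ (row-append-3 0 d e _))
read-insert (tableau a zero zero d e f) one s =
  row-cong 0 0 f (row-cong 0 d e (≡⇒≈ₚ (row-append-1 a s)))

∅ : Tableau
∅ = tableau 0 0 0 0 0 0

P : Word → Tableau
P = foldl insert ∅

reading : Tableau → Word
reading t = read t []

read-foldl-insert : ∀ t w → read t w ≈ₚ reading (foldl insert t w)
read-foldl-insert t []      = ≈-refl
read-foldl-insert t (l ∷ w) = read-insert t l w ⟫ read-foldl-insert (insert t l) w

≈ₚ-reading-P : ∀ w → w ≈ₚ reading (P w)
≈ₚ-reading-P = read-foldl-insert ∅

data Semistandard : Tableau → Set where
  semistandard : ∀ {a b c d e f} → f ≤ d → d ≤ a → d + e ≤ a + b → Semistandard (tableau a b c d e f)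

insert-semistandard : ∀ {t} l → Semistandard t → Semistandard (insert t l)
insert-semistandard {tableau a b c d e f} three (semistandard f≤d d≤a d+e≤a+b) =
  semistandard f≤d d≤a d+e≤a+b
insert-semistandard {tableau a b zero d e f} two (semistandard f≤d d≤a d+e≤a+b) =
  semistandard f≤d d≤a (≤-trans d+e≤a+b (+-monoʳ-≤ a (n≤1+n b)))
insert-semistandard {tableau a b (suc c) d e f} two (semistandard f≤d d≤a d+e≤a+b) =
  semistandard f≤d d≤a (subst₂ _≤_ (sym (+-suc d e)) (sym (+-suc a b)) (s≤s d+e≤a+b))
insert-semistandard {tableau a (suc b) c d zero f} one (semistandard f≤d d≤a _) =
  semistandard (m≤n⇒m≤1+n f≤d) (s≤s d≤a)
               (s≤s (subst (_≤ a + b) (sym (+-identityʳ d)) (≤-trans d≤a (m≤m+n a b))))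
insert-semistandard {tableau a (suc b) c d (suc e) f} one (semistandard f≤d d≤a d+e≤a+b) =
  semistandard (s≤s f≤d) (s≤s d≤a) (s≤s (≤-pred (subst₂ _≤_ (+-suc d e) (+-suc a b) d+e≤a+b)))
insert-semistandard {tableau a zero (suc c) d e f} one (semistandard f≤d d≤a d+e≤a+b) =
  semistandard f≤d (m≤n⇒m≤1+n d≤a) (subst (_≤ suc (a + 0)) (sym (+-suc d e)) (s≤s d+e≤a+b))
insert-semistandard {tableau a zero zero d e f} one (semistandard f≤d d≤a d+e≤a+b) =
  semistandard f≤d (m≤n⇒m≤1+n d≤a) (m≤n⇒m≤1+n d+e≤a+b)

foldl-insert-semistandard : ∀ {t} w → Semistandard t → Semistandard (foldl insert t w)
foldl-insert-semistandard []      ss = ss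
foldl-insert-semistandard (l ∷ w) ss = foldl-insert-semistandard w (insert-semistandard l ss)

P-semistandard : ∀ w → Semistandard (P w)
P-semistandard w = foldl-insert-semistandard w (semistandard z≤n z≤n z≤n)

-- Greene invariants of reading words

module _ {y : UT} (adm : Admissible y) (n : ℕ) where
  open Admissible adm
  private
    n+d₂≤n+a₁₂ = +-monoʳ-≤ n d₂≤a₁₂
    n+d₃≤n+a₂₃ = +-monoʳ-≤ n d₃≤a₂₃
    n+a₂₃≤n+a₁₃ = +-monoʳ-≤ n a₂₃≤a₁₃

  one^·₁ : mk n 0 0 n n 0 · y ≡ mk (n + d₁ y) (d₂ y) (d₃ y) (n + a₁₂ y) (n + a₁₃ y) (a₂₃ y)
  one^·₁ = UT-≡ refl refl refl (m≤n⇒m⊔n≡n n+d₂≤n+a₁₂)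
             (m≤n≤o⇒m∨n∨o≡o n+d₃≤n+a₂₃ n+a₂₃≤n+a₁₃) (m≤n⇒m⊔n≡n d₃≤a₂₃)

  two^·₁ : mk 0 n 0 n n n · y
    ≡ mk (d₁ y) (n + d₂ y) (d₃ y) (n + d₂ y ∨ a₁₂ y) (n + a₂₃ y ∨ a₁₃ y) (n + a₂₃ y)
  two^·₁ = UT-≡ refl refl refl refl (m≤n⇒m∨n∨o≡n∨o n+d₃≤n+a₂₃) (m≤n⇒m⊔n≡n n+d₃≤n+a₂₃)

  three^·₁ : mk 0 0 n 0 n n · y
    ≡ mk (d₁ y) (d₂ y) (n + d₃ y) (a₁₂ y) (n + d₃ y ∨ a₁₃ y) (n + d₃ y ∨ a₂₃ y)
  three^·₁ = UT-≡ refl refl refl (m≤n⇒m⊔n≡n d₂≤a₁₂)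
               (trans (⊔-assoc (n + d₃ y) _ _) (cong (n + d₃ y ∨_) (m≤n⇒m⊔n≡n a₂₃≤a₁₃))) refl

  one^·₃ : mk n n 0 n n n · y ≡ mk (n + d₁ y) (n + d₂ y) (d₃ y) (n + a₁₂ y) (n + a₁₃ y) (n + a₂₃ y)
  one^·₃ = UT-≡ refl refl refl (m≤n⇒m⊔n≡n n+d₂≤n+a₁₂)
             (m≤n≤o⇒m∨n∨o≡o n+d₃≤n+a₂₃ n+a₂₃≤n+a₁₃) (m≤n⇒m⊔n≡n n+d₃≤n+a₂₃)

  two^·₃ : mk n 0 n n n n · y
    ≡ mk (n + d₁ y) (d₂ y) (n + d₃ y) (n + a₁₂ y) (n + a₁₃ y) (n + d₃ y ∨ a₂₃ y)
  two^·₃ = UT-≡ refl refl refl (m≤n⇒m⊔n≡n n+d₂≤n+a₁₂)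
             (m≤n≤o⇒m∨n∨o≡o n+d₃≤n+a₂₃ n+a₂₃≤n+a₁₃) refl

  three^·₃ : mk 0 n n n n n · y
    ≡ mk (d₁ y) (n + d₂ y) (n + d₃ y) (n + d₂ y ∨ a₁₂ y) (n + a₂₃ y ∨ a₁₃ y) (n + a₂₃ y)
  three^·₃ = UT-≡ refl refl refl refl (m≤n⇒m∨n∨o≡n∨o n+d₃≤n+a₂₃) (m≤n⇒m⊔n≡n n+d₃≤n+a₂₃)

ρ₁-one^ : ∀ n → ρ L₁ (one ^ n) ≡ mk n 0 0 n n 0
ρ₁-one^ zero    = refl
ρ₁-one^ (suc n) rewrite ρ₁-one^ n = one^·₁ (admissible z≤n z≤n z≤n) 1

ρ₁-two^ : ∀ n → ρ L₁ (two ^ n) ≡ mk 0 n 0 n n n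
ρ₁-two^ zero    = refl
ρ₁-two^ (suc n) rewrite ρ₁-two^ n =
  trans (two^·₁ (admissible ≤-refl z≤n ≤-refl) 1) (UT-≡ refl refl refl (m+n∨n≡m+n 1 n) (m+n∨n≡m+n 1 n) refl)

ρ₁-three^ : ∀ n → ρ L₁ (three ^ n) ≡ mk 0 0 n 0 n n
ρ₁-three^ zero    = refl
ρ₁-three^ (suc n) rewrite ρ₁-three^ n =
  trans (three^·₁ (admissible z≤n ≤-refl ≤-refl) 1) (UT-≡ refl refl refl refl (m+n∨n≡m+n 1 n) (m+n∨n≡m+n 1 n))

ρ₃-one^ : ∀ n → ρ L₃ (one ^ n) ≡ mk n n 0 n n n
ρ₃-one^ zero    = refl
ρ₃-one^ (suc n) rewrite ρ₃-one^ n = one^·₃ (admissible ≤-refl z≤n ≤-refl) 1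

ρ₃-two^ : ∀ n → ρ L₃ (two ^ n) ≡ mk n 0 n n n n
ρ₃-two^ zero    = refl
ρ₃-two^ (suc n) rewrite ρ₃-two^ n =
  trans (two^·₃ (admissible z≤n ≤-refl ≤-refl) 1) (UT-≡ refl refl refl refl refl (m+n∨n≡m+n 1 n))

ρ₃-three^ : ∀ n → ρ L₃ (three ^ n) ≡ mk 0 n n n n n
ρ₃-three^ zero    = refl
ρ₃-three^ (suc n) rewrite ρ₃-three^ n =
  trans (three^·₃ (admissible ≤-refl ≤-refl ≤-refl) 1) (UT-≡ refl refl refl (m+n∨n≡m+n 1 n) (m+n∨n≡m+n 1 n) refl)

ρ-^-++ : ∀ {L} → (∀ l → Admissible (L l)) → ∀ l n w {p} → ρ L (l ^ n) ≡ p → ρ L (l ^ n ++ w) ≡ p · ρ L w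
ρ-^-++ {L} L-admissible l n w ρ[lⁿ]≡p = trans (ρ-++ L-admissible (l ^ n) w) (cong (_· ρ L w) ρ[lⁿ]≡p)

module _ (n : ℕ) (w : Word) where
  private
    y  = ρ L₁ w
    y′ = ρ L₃ w

  ρ₁-one^-++ : ρ L₁ (one ^ n ++ w) ≡ mk (n + d₁ y) (d₂ y) (d₃ y) (n + a₁₂ y) (n + a₁₃ y) (a₂₃ y)
  ρ₁-one^-++ = trans (ρ-^-++ L₁-admissible one n w (ρ₁-one^ n)) (one^·₁ (ρ-admissible L₁-admissible w) n)

  ρ₁-two^-++ : ρ L₁ (two ^ n ++ w)
    ≡ mk (d₁ y) (n + d₂ y) (d₃ y) (n + d₂ y ∨ a₁₂ y) (n + a₂₃ y ∨ a₁₃ y) (n + a₂₃ y)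
  ρ₁-two^-++ = trans (ρ-^-++ L₁-admissible two n w (ρ₁-two^ n)) (two^·₁ (ρ-admissible L₁-admissible w) n)

  ρ₁-three^-++ : ρ L₁ (three ^ n ++ w)
    ≡ mk (d₁ y) (d₂ y) (n + d₃ y) (a₁₂ y) (n + d₃ y ∨ a₁₃ y) (n + d₃ y ∨ a₂₃ y)
  ρ₁-three^-++ = trans (ρ-^-++ L₁-admissible three n w (ρ₁-three^ n))
      (three^·₁ (ρ-admissible L₁-admissible w) n)

  ρ₃-one^-++ : ρ L₃ (one ^ n ++ w)
    ≡ mk (n + d₁ y′) (n + d₂ y′) (d₃ y′) (n + a₁₂ y′) (n + a₁₃ y′) (n + a₂₃ y′)
  ρ₃-one^-++ = trans (ρ-^-++ L₃-admissible one n w (ρ₃-one^ n)) (one^·₃ (ρ-admissible L₃-admissible w) n)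

  ρ₃-two^-++ : ρ L₃ (two ^ n ++ w)
    ≡ mk (n + d₁ y′) (d₂ y′) (n + d₃ y′) (n + a₁₂ y′) (n + a₁₃ y′) (n + d₃ y′ ∨ a₂₃ y′)
  ρ₃-two^-++ = trans (ρ-^-++ L₃-admissible two n w (ρ₃-two^ n)) (two^·₃ (ρ-admissible L₃-admissible w) n)

  ρ₃-three^-++ : ρ L₃ (three ^ n ++ w)
    ≡ mk (d₁ y′) (n + d₂ y′) (n + d₃ y′) (n + d₂ y′ ∨ a₁₂ y′) (n + a₂₃ y′ ∨ a₁₃ y′) (n + a₂₃ y′)
  ρ₃-three^-++ = trans (ρ-^-++ L₃-admissible three n w (ρ₃-three^ n))
      (three^·₃ (ρ-admissible L₃-admissible w) n)

ρ₁-row : ∀ a b c → ρ L₁ (row a b c []) ≡ mk a b c (a + b) (a + (b + c)) (b + c)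
ρ₁-row a b c
  rewrite ρ₁-one^-++ a (two ^ b ++ three ^ c ++ []) | ρ₁-two^-++ b (three ^ c ++ [])
        | ++-identityʳ (three ^ c) | ρ₁-three^ c =
  UT-≡ (+-identityʳ a) (+-identityʳ b) refl (cong (a +_) (trans (⊔-identityʳ _) (+-identityʳ b)))
       (cong (a +_) (m+n∨n≡m+n b c)) refl

ρ₃-row : ∀ a b c → ρ L₃ (row a b c [])
  ≡ mk (a + b) (a + c) (b + c) (a + (b + c)) (a + (b + c)) (a + (b + c))
ρ₃-row a b c
  rewrite ρ₃-one^-++ a (two ^ b ++ three ^ c ++ []) | ρ₃-two^-++ b (three ^ c ++ [])
        | ++-identityʳ (three ^ c) | ρ₃-three^ c =
  UT-≡ (cong (a +_) (+-identityʳ b)) refl refl refl refl (cong (a +_) (m+n∨n≡m+n b c))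

Invariants : Set
Invariants = ℕ × ℕ × ℕ × ℕ × ℕ × ℕ

greene : Tableau → Invariants
greene (tableau a b c d e f) = a , d + b , f + (e + c) , a + b , a + (b + c) , d + (e + (a + (b + c)))

invariants : UT → UT → Invariants
invariants m m′ = d₁ m , d₂ m , d₃ m , a₁₂ m , a₁₃ m , a₁₃ m′

wordInvariants : Word → Invariants
wordInvariants w = invariants (ρ L₁ w) (ρ L₃ w)

wordInvariants-reading : ∀ {t} → Semistandard t → wordInvariants (reading t) ≡ greene t
wordInvariants-reading {tableau a b c d e f} (semistandard f≤d d≤a d+e≤a+b)
  rewrite ρ₁-three^-++ f (row 0 d e (row a b c [])) | ρ₁-two^-++ d (three ^ e ++ row a b c [])
        | ρ₁-three^-++ e (row a b c []) | ρ₁-row a b c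
        | ρ₃-three^-++ f (row 0 d e (row a b c [])) | ρ₃-two^-++ d (three ^ e ++ row a b c [])
        | ρ₃-three^-++ e (row a b c []) | ρ₃-row a b c
  = cong₂ (λ x y → a , d + b , f + (e + c) , x , y) a₁₂≡a+b (cong₂ _,_ a₁₃≡X a₁₃′≡d+e+X)
  where
  X = a + (b + c)
  lift : ∀ x y → x + y ≤ a + b → x + (y + c) ≤ X
  lift x y h = subst₂ _≤_ (+-assoc x y c) (+-assoc a b c) (+-monoˡ-≤ c h)
  e≤a+b = ≤-trans (m≤n+m e d) d+e≤a+b
  a₁₂≡a+b : d + b ∨ a + b ≡ a + b
  a₁₂≡a+b = m≤n⇒m⊔n≡n (+-monoˡ-≤ b d≤a)
  a₁₃≡X : f + (e + c) ∨ (d + (e + c ∨ b + c) ∨ (e + c ∨ X)) ≡ X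
  a₁₃≡X = trans (cong (λ z → f + (e + c) ∨ (d + (e + c ∨ b + c) ∨ z))
                      (m≤n⇒m⊔n≡n (lift 0 e e≤a+b)))
         (trans (cong (f + (e + c) ∨_)
                      (m≤n⇒m⊔n≡n (subst (_≤ X) (sym (+-distribˡ-⊔ d (e + c) (b + c)))
                                   (⊔-lub (lift d e d+e≤a+b) (+-monoˡ-≤ (b + c) d≤a)))))
                (m≤n⇒m⊔n≡n (lift f e (≤-trans (+-monoˡ-≤ e f≤d) d+e≤a+b))))
  a₁₃′≡d+e+X : f + (d + (e + (b + c)) ∨ e + X) ∨ d + (e + X ∨ X) ≡ d + (e + X)
  a₁₃′≡d+e+X = trans (cong (λ z → f + (d + (e + (b + c)) ∨ e + X) ∨ d + z) (m+n∨n≡m+n e X))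
    (m≤n⇒m⊔n≡n (subst (_≤ d + (e + X)) (sym (+-distribˡ-⊔ f (d + (e + (b + c))) (e + X))) (⊔-lub
      (subst (_≤ d + (e + X)) rearrange
               (+-monoʳ-≤ d (+-monoʳ-≤ e (+-monoˡ-≤ (b + c) (≤-trans f≤d d≤a)))))
      (+-monoˡ-≤ (e + X) f≤d))))
    where
    rearrange : d + (e + (f + (b + c))) ≡ f + (d + (e + (b + c)))
    rearrange = solve (f ∷ d ∷ e ∷ b ∷ c ∷ [])

greene-injective : ∀ t t′ → greene t ≡ greene t′ → t ≡ t′
greene-injective (tableau a b c d e f) (tableau a′ b′ c′ d′ e′ f′) eq
  with refl ← cong proj₁ eq
  with refl ← +-cancelˡ-≡ a b b′ (cong (proj₁ ∘ proj₂ ∘ proj₂ ∘ proj₂) eq)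
  with refl ← +-cancelˡ-≡ b c c′ (+-cancelˡ-≡ a _ _ (cong (proj₁ ∘ proj₂ ∘ proj₂ ∘ proj₂ ∘ proj₂) eq))
  with refl ← +-cancelʳ-≡ b d d′ (cong (proj₁ ∘ proj₂) eq)
  with refl ← +-cancelʳ-≡ (a + (b + c)) e e′
                (+-cancelˡ-≡ d _ _ (cong (proj₂ ∘ proj₂ ∘ proj₂ ∘ proj₂ ∘ proj₂) eq))
  with refl ← +-cancelʳ-≡ (e + c) f f′ (cong (proj₁ ∘ proj₂ ∘ proj₂) eq)
  = refl

wordInvariants-resp-≈ₚ : ∀ {w w′} → w ≈ₚ w′ → wordInvariants w ≡ wordInvariants w′
wordInvariants-resp-≈ₚ w≈w′ = cong₂ invariants (ρ-resp-≈ₚ L₁-admissible ρ₁-knuth w≈w′)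
                                  (ρ-resp-≈ₚ L₃-admissible ρ₃-knuth w≈w′)

wordInvariants-injective : ∀ {w w′} → wordInvariants w ≡ wordInvariants w′ → w ≈ₚ w′
wordInvariants-injective {w} {w′} eq =
  ≈ₚ-reading-P w ⟫ ≡⇒≈ₚ (cong reading P[w]≡P[w′]) ⟫ ≈-sym (≈ₚ-reading-P w′)
  where
  open ≡-Reasoning
  P[w]≡P[w′] : P w ≡ P w′
  P[w]≡P[w′] = greene-injective (P w) (P w′) (begin
    greene (P w)                    ≡⟨ wordInvariants-reading (P-semistandard w) ⟨
    wordInvariants (reading (P w))  ≡⟨ wordInvariants-resp-≈ₚ (≈ₚ-reading-P w) ⟨
    wordInvariants w                ≡⟨ eq ⟩
    wordInvariants w′               ≡⟨ wordInvariants-resp-≈ₚ (≈ₚ-reading-P w′) ⟩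
    wordInvariants (reading (P w′)) ≡⟨ wordInvariants-reading (P-semistandard w′) ⟩
    greene (P w′)                   ∎)

corollary5p4 : ∀ (x y : Word) →
    u₂ (x ++ y) (y ++ x) ≈ₚ v₂ (x ++ y) (y ++ x)
corollary5p4 x y = wordInvariants-injective
  (cong₂ invariants (ρ-u₂≡v₂ L₁-admissible x y) (ρ-u₂≡v₂ L₃-admissible x y))
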